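{- Suppose $\mathcal{A}=(A,\cdot,0,\leq)$ is an ordered semigroup with weak zero, and let $\mathcal{A}^{1'}$ be any compatible unital extension of $(A,\leq,\cdot)$ in which $1'\leq 0$ is false. Let $X=A^{1'}\setminus\{0\}$ (so $X_0=X\cup\{0\}=A^{1'}$). Then the map $s\mapsto\rho_s=\{(x,y):x,y\in A^{1'},\ \mathcal{A}^{1'}\models y\leq x\cdot s\}$ is an embedding of $\mathcal{A}$ into $(\mathrm{Ltrel}_0(X),\mathbin{;},\mathbf{0},\subseteq)$; i.e. it is injective, $\rho_{s\cdot t}=\rho_s\mathbin{;}\rho_t$, $\rho_0=\mathbf{0}$, each $\rho_s\in\mathrm{Ltrel}_0(X)$, and $s\leq t\iff\rho_s\subseteq\rho_t$.
   Context: An ordered semigroup is $(A,\leq,\cdot)$ with $\cdot$ associative, $\leq$ a partial order and $\cdot$ monotone in each argument. An ordered semigroup with weak zero is $(A,\cdot,0,\leq)$ where $(A,\cdot,\leq)$ is an ordered semigroup, $0$ is a semigroup zero, and $s\leq 0$ implies $s=0$. A compatible unital extension of an ordered semigroup $(A,\leq,\cdot)$ is an ordered monoid $(A^{1'},\leq,1',\cdot)$ (an ordered semigroup with identity $1'$) with $A^{1'}=A\cup\{1'\}$, $1'\notin A$, whose restriction to $A$ is the given ordered semigroup. For a set $X$ and $0\notin X$, $X_0=X\cup\{0\}$, $\mathrm{Ltrel}_0(X)$ is the set of left total relations $\rho$ on $X_0$ such that for all $s\in X_0$, $(0,s)\in\rho$ iff $s=0$, and $\mathbf{0}=\{(x,0):x\in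 X_0\}$. $s\mathbin{;}t=\{(x,y):\exists z((x,z)\in s\wedge(z,y)\in t)\}$. -}

module Defs where

open import Data.Maybe using (Maybe; just; nothing)
open import Data.Product using (Σ; ∃; _×_; _,_)
open import Relation.Binary.PropositionalEquality using (_≡_)
open import Relation.Binary.Structures using (IsPartialOrder)
open import Relation.Nullary using (¬_)

record IsOrderedSemigroup {A : Set} (_·_ : A → A → A) (_≤_ : A → A → Set) : Set where
  field
    assoc        : ∀ x y z → (x · y) · z ≡ x · (y · z)
    isPartialOrder : IsPartialOrder _≡_ _≤_
    monoˡ        : ∀ {x y} z → x ≤ y → (x · z) ≤ (y · z)
    monoʳ        : ∀ {x y} z → x ≤ y → (z · x) ≤ (z · y)

record OrderedSemigroupWithWeakZero (A : Set) : Set₁ where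
  field
    _·_   : A → A → A
    0#    : A
    _≤_   : A → A → Set
    isOrderedSemigroup : IsOrderedSemigroup _·_ _≤_
    zeroˡ : ∀ x → 0# · x ≡ 0#
    zeroʳ : ∀ x → x · 0# ≡ 0#
    weakZero : ∀ s → s ≤ 0# → s ≡ 0#

-- A compatible unital extension of (A, ≤, ·): an ordered monoid on
-- A^{1'} = A ∪ {1'}, represented as Maybe A with 1' = nothing and a ∈ A as just a,
-- whose restriction to A is the given ordered semigroup.
record CompatibleUnitalExtension {A : Set} (_·_ : A → A → A) (_≤_ : A → A → Set) : Set₁ where
  field
    _·'_ : Maybe A → Maybe A → Maybe A
    _≤'_ : Maybe A → Maybe A → Set
    isOrderedSemigroup' : IsOrderedSemigroup _·'_ _≤'_
    identityˡ : ∀ x → nothing ·' x ≡ x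
    identityʳ : ∀ x → x ·' nothing ≡ x
    restrict-· : ∀ a b → just a ·' just b ≡ just (a · b)
    restrict-≤ˡ : ∀ a b → just a ≤' just b → a ≤ b
    restrict-≤ʳ : ∀ a b → a ≤ b → just a ≤' just b

BRel : Set → Set₁
BRel B = B → B → Set

_⨟_ : {B : Set} → BRel B → BRel B → BRel B
(s ⨟ t) x y = ∃ λ z → s x z × t z y

_⊆ᵣ_ : {B : Set} → BRel B → BRel B → Set
s ⊆ᵣ t = ∀ x y → s x y → t x y

_≐_ : {B : Set} → BRel B → BRel B → Set
s ≐ t = (s ⊆ᵣ t) × (t ⊆ᵣ s)

-- Ltrel₀(X) with X₀ = B and distinguished element 0 = z:
-- left total, and (0,s) ∈ ρ iff s = 0.
IsLtrel₀ : {B : Set} → B → BRel B → Set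
IsLtrel₀ {B} z ρ = (∀ x → ∃ λ y → ρ x y) × (∀ s → (ρ z s → s ≡ z) × (s ≡ z → ρ z s))

zeroRel : {B : Set} → B → BRel B
zeroRel z x y = y ≡ z

ρ : {A : Set} {_·_ : A → A → A} {_≤_ : A → A → Set} →
    CompatibleUnitalExtension _·_ _≤_ → A → BRel (Maybe A)
ρ E s x y = y ≤' (x ·' just s)
  where open CompatibleUnitalExtension E

-- The extension A^{1'} acts on itself by right multiplication, and ρ_s is the
-- down-closure of the graph of x ↦ x · s.  Monotonicity and associativity give
-- ρ_{s·t} = ρ_s ; ρ_t, and evaluating at the unit 1' recovers s from ρ_s
-- (since (1', y) ∈ ρ_s iff y ≤ s), which yields order reflection and injectivity.
-- The hypothesis 1' ≰ 0 makes 0 a weak zero of A^{1'} as well, so the only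
-- element related to 0 is 0 itself.
module Submission where

open import Defs
open import Data.Maybe using (Maybe; just; nothing)
open import Data.Product using (_×_; _,_)
open import Data.Empty using (⊥-elim)
open import Function.Bundles using (_⇔_; mk⇔)
open import Relation.Binary.PropositionalEquality using (_≡_; refl; sym; trans; cong)
open import Relation.Binary.Structures using (IsPartialOrder)
open import Relation.Nullary using (¬_)

module RightRegularRepresentation {A : Set} (𝒜 : OrderedSemigroupWithWeakZero A)
  (E : CompatibleUnitalExtension (OrderedSemigroupWithWeakZero._·_ 𝒜)
                                 (OrderedSemigroupWithWeakZero._≤_ 𝒜)) where

  open OrderedSemigroupWithWeakZero 𝒜
  open CompatibleUnitalExtension E
  open IsOrderedSemigroup isOrderedSemigroup using (isPartialOrder)
  open IsOrderedSemigroup isOrderedSemigroup' using (assoc; monoˡ; monoʳ)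
    renaming (isPartialOrder to isPartialOrder')
  open IsPartialOrder isPartialOrder using (antisym)
  open IsPartialOrder isPartialOrder' using (≤-respʳ-≈)
    renaming (refl to ≤'-refl; reflexive to ≤'-reflexive; trans to ≤'-trans)

  ·'-zeroˡ : ∀ x → just 0# ·' x ≡ just 0#
  ·'-zeroˡ nothing  = identityʳ (just 0#)
  ·'-zeroˡ (just a) = trans (restrict-· 0# a) (cong just (zeroˡ a))

  ·'-zeroʳ : ∀ x → x ·' just 0# ≡ just 0#
  ·'-zeroʳ nothing  = identityˡ (just 0#)
  ·'-zeroʳ (just a) = trans (restrict-· a 0#) (cong just (zeroʳ a))

  ρ-image : ∀ s x → ρ E s x (x ·' just s)
  ρ-image s x = ≤'-refl

  ρ-unit⇒≤ : ∀ s y → ρ E s nothing y → y ≤' just s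
  ρ-unit⇒≤ s y = ≤-respʳ-≈ (identityˡ (just s))

  ρ-unit-self : ∀ s → ρ E s nothing (just s)
  ρ-unit-self s = ≤'-reflexive (sym (identityˡ (just s)))

  ρ-mono : ∀ {s t} → s ≤ t → ρ E s ⊆ᵣ ρ E t
  ρ-mono {s} {t} s≤t x y y≤xs = ≤'-trans y≤xs (monoʳ x (restrict-≤ʳ s t s≤t))

  ρ-reflects-≤ : ∀ {s t} → ρ E s ⊆ᵣ ρ E t → s ≤ t
  ρ-reflects-≤ {s} {t} ρs⊆ρt =
    restrict-≤ˡ s t (ρ-unit⇒≤ t (just s) (ρs⊆ρt nothing (just s) (ρ-unit-self s)))

  ρ-injective : ∀ s t → ρ E s ≐ ρ E t → s ≡ t
  ρ-injective s t (ρs⊆ρt , ρt⊆ρs) = antisym (ρ-reflects-≤ ρs⊆ρt) (ρ-reflects-≤ ρt⊆ρs)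

  ρ-homo : ∀ s t → ρ E (s · t) ≐ (ρ E s ⨟ ρ E t)
  ρ-homo s t = ρ-·⊆⨟ , ρ-⨟⊆·
    where
    x·s·t≡x·st : ∀ x → (x ·' just s) ·' just t ≡ x ·' just (s · t)
    x·s·t≡x·st x = trans (assoc x (just s) (just t)) (cong (x ·'_) (restrict-· s t))

    ρ-·⊆⨟ : ρ E (s · t) ⊆ᵣ (ρ E s ⨟ ρ E t)
    ρ-·⊆⨟ x y y≤x·st =
      x ·' just s , ρ-image s x , ≤-respʳ-≈ (sym (x·s·t≡x·st x)) y≤x·st

    ρ-⨟⊆· : (ρ E s ⨟ ρ E t) ⊆ᵣ ρ E (s · t)
    ρ-⨟⊆· x y (z , z≤x·s , y≤z·t) =
      ≤'-trans y≤z·t (≤-respʳ-≈ (x·s·t≡x·st x) (monoˡ (just t) z≤x·s))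

  module _ (unit≰0 : ¬ nothing ≤' just 0#) where

    weakZero' : ∀ y → y ≤' just 0# → y ≡ just 0#
    weakZero' nothing  1'≤0 = ⊥-elim (unit≰0 1'≤0)
    weakZero' (just b) b≤0  = cong just (weakZero b (restrict-≤ˡ b 0# b≤0))

    ρ-related-to-zero : ∀ s x y → x ·' just s ≡ just 0# → ρ E s x y → y ≡ just 0#
    ρ-related-to-zero s x y x·s≡0 y≤x·s = weakZero' y (≤-respʳ-≈ x·s≡0 y≤x·s)

    ρ-zero : ρ E 0# ≐ zeroRel (just 0#)
    ρ-zero = (λ x y → ρ-related-to-zero 0# x y (·'-zeroʳ x))
           , λ { x _ refl → ≤'-reflexive (sym (·'-zeroʳ x)) }

    ρ-isLtrel₀ : ∀ s → IsLtrel₀ (just 0#) (ρ E s)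
    ρ-isLtrel₀ s =
      (λ x → x ·' just s , ρ-image s x)
      , λ y → ρ-related-to-zero s (just 0#) y (·'-zeroˡ (just s))
            , λ { refl → ≤'-reflexive (sym (·'-zeroˡ (just s))) }

mainTheorem18 : {A : Set} (𝒜 : OrderedSemigroupWithWeakZero A)
    → let open OrderedSemigroupWithWeakZero 𝒜 in
    (E : CompatibleUnitalExtension _·_ _≤_)
    → ¬ CompatibleUnitalExtension._≤'_ E nothing (just 0#)
    → (∀ s t → ρ E s ≐ ρ E t → s ≡ t)
    × (∀ s t → ρ E (s · t) ≐ (ρ E s ⨟ ρ E t))
    × (ρ E 0# ≐ zeroRel (just 0#))
    × (∀ s → IsLtrel₀ (just 0#) (ρ E s))
    × (∀ s t → (s ≤ t) ⇔ (ρ E s ⊆ᵣ ρ E t))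
mainTheorem18 𝒜 E unit≰0 =
  ρ-injective , ρ-homo , ρ-zero unit≰0 , ρ-isLtrel₀ unit≰0
  , λ s t → mk⇔ ρ-mono ρ-reflects-≤
  where open RightRegularRepresentation 𝒜 E
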